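{- For every type $\sigma$ and all closed values $V,W$ of type $\sigma$ of $\mathsf{PCFL}_\oplus$, $(\hat V,\sigma)\precsim(\hat W,\sigma)$ if and only if $(V,\sigma)\precsim(W,\sigma)$, where $\precsim$ is similarity on the labelled Markov chain $\mathcal{M}_\oplus$.
   Context: $\mathsf{PCFL}_\oplus$. Terms: $M,N,L::= x\mid \underline{n}\mid \underline{b}\mid \mathsf{nil}\mid \langle M,N\rangle\mid M::N\mid \lambda x.M\mid \mathsf{fix}\,x.M\mid M\oplus N\mid \mathsf{if}\ L\ \mathsf{then}\ M\ \mathsf{else}\ N\mid \mathsf{op}(M,N)\mid \mathsf{fst}\,M\mid \mathsf{snd}\,M\mid \mathsf{case}\ L\ \mathsf{of}\ \{\mathsf{nil}\to M\mid h::t\to N\}\mid MN$ ($n\in\mathbb{N}$, $b$ boolean, $\mathsf{op}$ from a finite set of binary operators on naturals with result type $\mathbf{int}$ or $\mathbf{bool}$; $\mathsf{fix}\,x.M$ binds $x$). Types: $\sigma::=\mathbf{bool}\mid\mathbf{int}\mid\sigma\to\sigma\mid\sigma\times\sigma\mid[\sigma]$ with standard simply-typed rules ($\Gamma\vdash\mathsf{fix}\,x.M:\sigma\to\tau$ if $\Gamma,x:\sigma\to\tau\vdash M:\sigma\to\tau$). Values: $\underline n,\underline b,\mathsf{nil},\lambda x.M,\mathsf{fix}\,x.M,M::N,\langle M,N\rangle$. Call-by-value semantics: evaluation contexts $E::=[\cdot]\mid EM\mid VE\mid \mathsf{op}(E,M)\mid\mathsf{op}(V,E)\mid\mathsf{fst}\,E\mid\mathsf{snd}\,E\mid\mathsf{if}\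 E\ \mathsf{then}\ M\ \mathsf{else}\ N\mid \mathsf{case}\ E\ \mathsf{of}\{\dots\}\mid\mathsf{case}\ (E::M)\ \mathsf{of}\{\dots\}\mid\mathsf{case}\ (V::E)\ \mathsf{of}\{\dots\}$; one-step reduction: $(\lambda x.M)V\to M[V/x]$; $(\mathsf{fix}\,x.M)V\to (M[\mathsf{fix}\,x.M/x])V$; $\mathsf{op}(\underline n,\underline m)\to$ result; $\mathsf{fst}\langle M,N\rangle\to M$; $\mathsf{snd}\langle M,N\rangle\to N$; $\mathsf{if}$ on boolean constants selects a branch; $\mathsf{case}\ \mathsf{nil}\to$ first branch; $\mathsf{case}\ V::W\to N[V/h,W/t]$; $M\oplus N\to M,N$; closed under evaluation contexts. $\Rightarrow$: $M\Rightarrow\emptyset$; $V\Rightarrow\{V^1\}$; if $M\to N_1,\dots,N_n$ and $N_i\Rightarrow\mathscr{D}_i$ then $M\Rightarrow\sum_i\frac1n\mathscr{D}_i$; $[\![M]\!]$ is the supremum of such $\mathscr{D}$ (so $[\![V]\!]=\{V^1\}$ for a value $V$). Labelled Markov chain $\mathcal{M}_\oplus$: states $(M,\sigma)$ (closed $M:\sigma$) and $(\hat V,\sigma)$ (closed values, distinct copies); labels: types, closed values, naturals, booleans, $\mathit{nil},\mathit{hd},\mathit{tl},\mathit{fst},\mathit{snd},\mathit{eval}$. Transitions (probability 1 unless stated): any state of type $\sigma$ goes by label $\sigma$ to itself; $(M,\sigma)\xrightarrow{\mathit{eval}}(\hat V,\sigma)$ with probability $[\![M]\!](V)$; for closed values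 $W:\tau$, $(\widehat{\lambda x.M},\tau\to\theta)\xrightarrow{W}(M[W/x],\theta)$, $(\widehat{\mathsf{fix}\,x.M},\tau\to\theta)\xrightarrow{W}((M[\mathsf{fix}\,x.M/x])W,\theta)$; $(\widehat{\langle M,N\rangle},\tau\times\theta)\xrightarrow{\mathit{fst}}(M,\tau)$, $\xrightarrow{\mathit{snd}}(N,\theta)$; $(\hat{\underline k},\mathbf{int})\xrightarrow{k}$ itself; $(\hat{\underline b},\mathbf{bool})\xrightarrow{b}$ itself; $(\hat{\mathsf{nil}},[\tau])\xrightarrow{\mathit{nil}}$ itself; $(\widehat{M::N},[\tau])\xrightarrow{\mathit{hd}}(M,\tau)$, $\xrightarrow{\mathit{tl}}(N,[\tau])$; all others 0. A simulation is a preorder $R$ on states with $sRt\Rightarrow\mathcal{P}_\oplus(s,l,X)\leq\mathcal{P}_\oplus(t,l,R(X))$ for all labels $l$ and sets $X$ of states ($R(X)=\{y\mid\exists x\in X,xRy\}$, $\mathcal{P}(s,l,X)=\sum_{x\in X}\mathcal{P}(s,l,x)$); similarity $\precsim$ is the union of all simulations (itself a simulation). -}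

module Defs where

open import Data.Nat using (ℕ; zero; suc)
open import Data.Fin using (Fin)
open import Data.Bool using (Bool; true; false)
open import Data.Integer using (+_)
open import Data.Rational using (ℚ; 0ℚ; 1ℚ; _/_; _+_; _*_; _<_; _≤_)
open import Data.List using (List; []; _∷_; map; concat; length)
open import Data.List.Relation.Binary.Pointwise using (Pointwise)
open import Data.List.Relation.Unary.All using (All)
open import Data.List.Relation.Unary.Unique.Propositional using (Unique)
open import Data.Product using (Σ; ∃; _×_; _,_)
open import Relation.Binary.PropositionalEquality using (_≡_; _≢_)
open import Relation.Binary.Structures using (IsPreorder)

data Ty : Set where
  bool int : Ty
  _⇒_ _⊗_ : Ty → Ty → Ty
  list : Ty → Ty

record OpSig : Set where
  field
    nI nB : ℕ
    semI : Fin nI → ℕ → ℕ → ℕ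
    semB : Fin nB → ℕ → ℕ → Bool

module PCFL (O : OpSig) where
  open OpSig O

  -- Terms (Curry style, de Bruijn indices).
  -- lam M, fix M bind index 0; in  case L M N  the branch N binds
  -- h = index 1 and t = index 0.
  data Tm : Set where
    var  : ℕ → Tm
    nat  : ℕ → Tm
    bl   : Bool → Tm
    nil  : Tm
    pair : Tm → Tm → Tm
    cons : Tm → Tm → Tm
    lam  : Tm → Tm
    fix  : Tm → Tm
    _⊕_  : Tm → Tm → Tm
    ifte : Tm → Tm → Tm → Tm
    opI  : Fin nI → Tm → Tm → Tm
    opB  : Fin nB → Tm → Tm → Tm
    fst snd : Tm → Tm
    case : Tm → Tm → Tm → Tm
    app  : Tm → Tm → Tm

  ext : (ℕ → ℕ) → ℕ → ℕ
  ext ρ zero = zero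
  ext ρ (suc n) = suc (ρ n)

  rename : (ℕ → ℕ) → Tm → Tm
  rename ρ (var x) = var (ρ x)
  rename ρ (nat n) = nat n
  rename ρ (bl b) = bl b
  rename ρ nil = nil
  rename ρ (pair M N) = pair (rename ρ M) (rename ρ N)
  rename ρ (cons M N) = cons (rename ρ M) (rename ρ N)
  rename ρ (lam M) = lam (rename (ext ρ) M)
  rename ρ (fix M) = fix (rename (ext ρ) M)
  rename ρ (M ⊕ N) = rename ρ M ⊕ rename ρ N
  rename ρ (ifte L M N) = ifte (rename ρ L) (rename ρ M) (rename ρ N)
  rename ρ (opI o M N) = opI o (rename ρ M) (rename ρ N)
  rename ρ (opB o M N) = opB o (rename ρ M) (rename ρ N)
  rename ρ (fst M) = fst (rename ρ M)
  rename ρ (snd M) = snd (rename ρ M)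
  rename ρ (case L M N) = case (rename ρ L) (rename ρ M) (rename (ext (ext ρ)) N)
  rename ρ (app M N) = app (rename ρ M) (rename ρ N)

  exts : (ℕ → Tm) → ℕ → Tm
  exts σ zero = var zero
  exts σ (suc n) = rename suc (σ n)

  subst : (ℕ → Tm) → Tm → Tm
  subst σ (var x) = σ x
  subst σ (nat n) = nat n
  subst σ (bl b) = bl b
  subst σ nil = nil
  subst σ (pair M N) = pair (subst σ M) (subst σ N)
  subst σ (cons M N) = cons (subst σ M) (subst σ N)
  subst σ (lam M) = lam (subst (exts σ) M)
  subst σ (fix M) = fix (subst (exts σ) M)
  subst σ (M ⊕ N) = subst σ M ⊕ subst σ N
  subst σ (ifte L M N) = ifte (subst σ L) (subst σ M) (subst σ N)
  subst σ (opI o M N) = opI o (subst σ M) (subst σ N)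
  subst σ (opB o M N) = opB o (subst σ M) (subst σ N)
  subst σ (fst M) = fst (subst σ M)
  subst σ (snd M) = snd (subst σ M)
  subst σ (case L M N) = case (subst σ L) (subst σ M) (subst (exts (exts σ)) N)
  subst σ (app M N) = app (subst σ M) (subst σ N)

  _[_] : Tm → Tm → Tm
  M [ N ] = subst σ M
    where
    σ : ℕ → Tm
    σ zero = N
    σ (suc n) = var n

  _[_,_]₂ : Tm → Tm → Tm → Tm
  N [ V , W ]₂ = subst σ N
    where
    σ : ℕ → Tm
    σ zero = W
    σ (suc zero) = V
    σ (suc (suc n)) = var n

  Ctx : Set
  Ctx = List Ty

  data _∋_∶_ : Ctx → ℕ → Ty → Set where
    here  : ∀ {Γ σ} → (σ ∷ Γ) ∋ zero ∶ σ
    there : ∀ {Γ σ τ n} → Γ ∋ n ∶ σ → (τ ∷ Γ) ∋ suc n ∶ σ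

  data _⊢_∶_ (Γ : Ctx) : Tm → Ty → Set where
    ⊢var  : ∀ {x σ} → Γ ∋ x ∶ σ → Γ ⊢ var x ∶ σ
    ⊢nat  : ∀ {n} → Γ ⊢ nat n ∶ int
    ⊢bl   : ∀ {b} → Γ ⊢ bl b ∶ bool
    ⊢nil  : ∀ {σ} → Γ ⊢ nil ∶ list σ
    ⊢pair : ∀ {M N σ τ} → Γ ⊢ M ∶ σ → Γ ⊢ N ∶ τ → Γ ⊢ pair M N ∶ (σ ⊗ τ)
    ⊢cons : ∀ {M N σ} → Γ ⊢ M ∶ σ → Γ ⊢ N ∶ list σ → Γ ⊢ cons M N ∶ list σ
    ⊢lam  : ∀ {M σ τ} → (σ ∷ Γ) ⊢ M ∶ τ → Γ ⊢ lam M ∶ (σ ⇒ τ)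
    ⊢fix  : ∀ {M σ τ} → ((σ ⇒ τ) ∷ Γ) ⊢ M ∶ (σ ⇒ τ) → Γ ⊢ fix M ∶ (σ ⇒ τ)
    ⊢⊕    : ∀ {M N σ} → Γ ⊢ M ∶ σ → Γ ⊢ N ∶ σ → Γ ⊢ M ⊕ N ∶ σ
    ⊢if   : ∀ {L M N σ} → Γ ⊢ L ∶ bool → Γ ⊢ M ∶ σ → Γ ⊢ N ∶ σ → Γ ⊢ ifte L M N ∶ σ
    ⊢opI  : ∀ {o M N} → Γ ⊢ M ∶ int → Γ ⊢ N ∶ int → Γ ⊢ opI o M N ∶ int
    ⊢opB  : ∀ {o M N} → Γ ⊢ M ∶ int → Γ ⊢ N ∶ int → Γ ⊢ opB o M N ∶ bool
    ⊢fst  : ∀ {M σ τ} → Γ ⊢ M ∶ (σ ⊗ τ) → Γ ⊢ fst M ∶ σ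
    ⊢snd  : ∀ {M σ τ} → Γ ⊢ M ∶ (σ ⊗ τ) → Γ ⊢ snd M ∶ τ
    ⊢case : ∀ {L M N σ τ} → Γ ⊢ L ∶ list σ → Γ ⊢ M ∶ τ
          → (list σ ∷ σ ∷ Γ) ⊢ N ∶ τ → Γ ⊢ case L M N ∶ τ
    ⊢app  : ∀ {M N σ τ} → Γ ⊢ M ∶ (σ ⇒ τ) → Γ ⊢ N ∶ σ → Γ ⊢ app M N ∶ τ

  data Value : Tm → Set where
    v-nat  : ∀ {n} → Value (nat n)
    v-bl   : ∀ {b} → Value (bl b)
    v-nil  : Value nil
    v-lam  : ∀ {M} → Value (lam M)
    v-fix  : ∀ {M} → Value (fix M)
    v-cons : ∀ {M N} → Value (cons M N)
    v-pair : ∀ {M N} → Value (pair M N)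

  -- One-step reduction  M → N₁,…,Nₙ  written  Step M (N₁ ∷ … ∷ Nₙ ∷ [])

  data Step : Tm → List Tm → Set where
    β-lam  : ∀ {M V} → Value V → Step (app (lam M) V) ((M [ V ]) ∷ [])
    β-fix  : ∀ {M V} → Value V → Step (app (fix M) V) (app (M [ fix M ]) V ∷ [])
    β-opI  : ∀ {o n m} → Step (opI o (nat n) (nat m)) (nat (semI o n m) ∷ [])
    β-opB  : ∀ {o n m} → Step (opB o (nat n) (nat m)) (bl (semB o n m) ∷ [])
    β-fst  : ∀ {M N} → Step (fst (pair M N)) (M ∷ [])
    β-snd  : ∀ {M N} → Step (snd (pair M N)) (N ∷ [])
    β-ift  : ∀ {M N} → Step (ifte (bl true) M N) (M ∷ [])
    β-iff  : ∀ {M N} → Step (ifte (bl false) M N) (N ∷ [])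
    β-nil  : ∀ {M N} → Step (case nil M N) (M ∷ [])
    β-cons : ∀ {V W M N} → Value V → Value W
           → Step (case (cons V W) M N) ((N [ V , W ]₂) ∷ [])
    β-⊕    : ∀ {M N} → Step (M ⊕ N) (M ∷ N ∷ [])
    ξ-app₁  : ∀ {M L Ns} → Step M Ns → Step (app M L) (map (λ N → app N L) Ns)
    ξ-app₂  : ∀ {V M Ns} → Value V → Step M Ns → Step (app V M) (map (app V) Ns)
    ξ-opI₁  : ∀ {o M L Ns} → Step M Ns → Step (opI o M L) (map (λ N → opI o N L) Ns)
    ξ-opI₂  : ∀ {o V M Ns} → Value V → Step M Ns → Step (opI o V M) (map (opI o V) Ns)
    ξ-opB₁  : ∀ {o M L Ns} → Step M Ns → Step (opB o M L) (map (λ N → opB o N L) Ns)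
    ξ-opB₂  : ∀ {o V M Ns} → Value V → Step M Ns → Step (opB o V M) (map (opB o V) Ns)
    ξ-fst   : ∀ {M Ns} → Step M Ns → Step (fst M) (map fst Ns)
    ξ-snd   : ∀ {M Ns} → Step M Ns → Step (snd M) (map snd Ns)
    ξ-if    : ∀ {L A B Ns} → Step L Ns → Step (ifte L A B) (map (λ N → ifte N A B) Ns)
    ξ-case  : ∀ {L A B Ns} → Step L Ns → Step (case L A B) (map (λ N → case N A B) Ns)
    ξ-case₁ : ∀ {M L A B Ns} → Step M Ns
            → Step (case (cons M L) A B) (map (λ N → case (cons N L) A B) Ns)
    ξ-case₂ : ∀ {V M A B Ns} → Value V → Step M Ns
            → Step (case (cons V M) A B) (map (λ N → case (cons V N) A B) Ns)

  -- Finite (sub)distributions as formal sums  Σ pᵢ·Vᵢ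

  Dist : Set
  Dist = List (Tm × ℚ)

  -- 1/n (only ever used with n ≥ 1)
  inv : ℕ → ℚ
  inv zero = 0ℚ
  inv (suc k) = + 1 / suc k

  average : ℕ → List Dist → Dist
  average n Ds = map (λ { (t , p) → (t , p * inv n) }) (concat Ds)

  data Weight : Dist → Tm → ℚ → Set where
    w[] : ∀ {V} → Weight [] V 0ℚ
    w≡  : ∀ {D V p w} → Weight D V w → Weight ((V , p) ∷ D) V (p + w)
    w≢  : ∀ {D V W p w} → W ≢ V → Weight D V w → Weight ((W , p) ∷ D) V w

  data _⇓_ : Tm → Dist → Set where
    ⇓∅    : ∀ {M} → M ⇓ []
    ⇓val  : ∀ {V} → Value V → V ⇓ ((V , 1ℚ) ∷ [])
    ⇓step : ∀ {M Ns Ds} → Step M Ns → Pointwise _⇓_ Ns Ds → M ⇓ average (length Ns) Ds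

  -- Nonnegative reals are represented by their strict lower cuts
  -- (predicates on ℚ):  q ∈ x  iff  q < x.
  -- Sem M V q  iff  q < [[M]](V) = sup { D(V) | M ⇒ D }.
  Sem : Tm → Tm → ℚ → Set
  Sem M V q = Σ Dist λ D → M ⇓ D × Σ ℚ λ w → Weight D V w × q < w

  data State : Set where
    st  : (M : Tm) (σ : Ty) → .([] ⊢ M ∶ σ) → State
    hst : (V : Tm) (σ : Ty) → .([] ⊢ V ∶ σ) → .(Value V) → State

  tyOf : State → Ty
  tyOf (st _ σ _) = σ
  tyOf (hst _ σ _ _) = σ

  data Label : Set where
    lty   : Ty → Label
    lval  : Tm → Label
    lnat  : ℕ → Label
    lbool : Bool → Label
    lnil lhd ltl lfst lsnd leval : Label

  -- Tr s l x q  iff  q < P⊕(s, l, x)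
  data Tr : State → Label → State → ℚ → Set where
    neg   : ∀ {s l x q} → q < 0ℚ → Tr s l x q
    self  : ∀ {s q} → q < 1ℚ → Tr s (lty (tyOf s)) s q
    eval  : ∀ {M V σ q} .{p p' v} → Sem M V q → Tr (st M σ p) leval (hst V σ p' v) q
    lamT  : ∀ {M W τ θ q} .{p v p'} → Value W → [] ⊢ W ∶ τ → q < 1ℚ
          → Tr (hst (lam M) (τ ⇒ θ) p v) (lval W) (st (M [ W ]) θ p') q
    fixT  : ∀ {M W τ θ q} .{p v p'} → Value W → [] ⊢ W ∶ τ → q < 1ℚ
          → Tr (hst (fix M) (τ ⇒ θ) p v) (lval W) (st (app (M [ fix M ]) W) θ p') q
    fstT  : ∀ {M N τ θ q} .{p v p'} → q < 1ℚ
          → Tr (hst (pair M N) (τ ⊗ θ) p v) lfst (st M τ p') q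
    sndT  : ∀ {M N τ θ q} .{p v p'} → q < 1ℚ
          → Tr (hst (pair M N) (τ ⊗ θ) p v) lsnd (st N θ p') q
    natT  : ∀ {k q} .{p v} → q < 1ℚ
          → Tr (hst (nat k) int p v) (lnat k) (hst (nat k) int p v) q
    boolT : ∀ {b q} .{p v} → q < 1ℚ
          → Tr (hst (bl b) bool p v) (lbool b) (hst (bl b) bool p v) q
    nilT  : ∀ {τ q} .{p v} → q < 1ℚ
          → Tr (hst nil (list τ) p v) lnil (hst nil (list τ) p v) q
    hdT   : ∀ {M N τ q} .{p v p'} → q < 1ℚ
          → Tr (hst (cons M N) (list τ) p v) lhd (st M τ p') q
    tlT   : ∀ {M N τ q} .{p v p'} → q < 1ℚ
          → Tr (hst (cons M N) (list τ) p v) ltl (st N (list τ) p') q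

  -- SumTr s l xs q  iff  q < Σ_{x ∈ xs} P⊕(s, l, x)
  data SumTr (s : State) (l : Label) : List State → ℚ → Set where
    s[] : ∀ {q} → q < 0ℚ → SumTr s l [] q
    s∷  : ∀ {x xs q r t} → Tr s l x r → SumTr s l xs t → q ≤ r + t
        → SumTr s l (x ∷ xs) q

  -- P s l X q  iff  q < P⊕(s, l, X) = Σ_{x ∈ X} P⊕(s, l, x)
  -- (supremum of the finite partial sums over duplicate-free lists in X)
  P : State → Label → (State → Set) → ℚ → Set
  P s l X q = Σ (List State) λ xs → Unique xs × All X xs × SumTr s l xs q

  _≤ᵣ_ : (ℚ → Set) → (ℚ → Set) → Set
  a ≤ᵣ b = ∀ q → a q → b q

  Img : (State → State → Set) → (State → Set) → State → Set
  Img R X y = Σ State λ x → X x × R x y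

  record Simulation (R : State → State → Set) : Set₁ where
    field
      preorder : IsPreorder _≡_ R
      sim : ∀ s t → R s t → ∀ (l : Label) (X : State → Set)
          → P s l X ≤ᵣ P t l (Img R X)

  _≾_ : State → State → Set₁
  s ≾ t = Σ (State → State → Set) λ R → Simulation R × R s t

module Submission where

-- The argument rests on one observation about the Markov chain M⊕: a
-- term state (V, σ) whose term is a value has exactly two transitions of
-- positive probability, each of probability 1 — the type label σ back to
-- itself, and  eval  to its hatted copy (V̂, σ)  (a value does not reduce,
-- so [[V]] = {V¹}).  From this we get
--   * (⇐) if a simulation relates (V,σ) to (W,σ), matching the eval step
--     of (V,σ) forces (W,σ) to reach R({V̂}) by eval, whose only target is
--     Ŵ; hence V̂ R Ŵ;
--   * (⇒) given a simulation R with V̂ R Ŵ, the relation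
--     R⁺ = R ∪ (R ; {((V,σ),(W,σ))} ; R) is again a simulation: a general
--     "extension" lemma reduces this to a one-step check of the new pair,
--     and that check is the two-transition description above.

open import Defs
open import Function.Base using (_∘_)
open import Function.Bundles using (_⇔_; mk⇔)
open import Data.List using ([]; _∷_)
open import Data.List.Relation.Unary.All as All using (All; []; _∷_)
open import Data.List.Relation.Unary.Any using (here; there)
open import Data.List.Membership.Propositional using (_∈_)
open import Data.List.Relation.Unary.Unique.Propositional using (Unique)
open import Data.List.Relation.Unary.AllPairs using ([]; _∷_)
open import Data.Product using (Σ; _×_; _,_)
open import Data.Sum using (_⊎_; inj₁; inj₂)
open import Data.Empty using (⊥; ⊥-elim)
open import Data.Rational using (0ℚ; 1ℚ; _+_; _<_; -_)
import Data.Rational.Properties as ℚ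
open import Algebra.Properties.AbelianGroup ℚ.+-0-abelianGroup using (xyx⁻¹≈y)
open import Relation.Binary.PropositionalEquality
  using (_≡_; refl; sym; trans; isEquivalence) renaming (subst to transport)
open import Relation.Binary.Structures using (IsPreorder)

module _ (O : OpSig) where
  open PCFL O

  -- A sum with a single summand of probability 1 exceeds every q < 1.
  -- (Needed because masses are lower cuts: we split q = z + (q - z)
  -- with q < z < 1.)
  singletonSum : ∀ {s l y q} → (∀ r → r < 1ℚ → Tr s l y r) → q < 1ℚ
               → SumTr s l (y ∷ []) q
  singletonSum {q = q} tr q<1 with ℚ.<-dense q<1
  ... | z , q<z , z<1 = s∷ (tr z z<1) (s[] q-z<0) (ℚ.≤-reflexive (sym z+[q-z]≡q))
    where
    q-z<0 : q + - z < 0ℚ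
    q-z<0 = transport (q + - z <_) (ℚ.+-inverseʳ z) (ℚ.+-monoˡ-< (- z) q<z)
    z+[q-z]≡q : z + (q + - z) ≡ q
    z+[q-z]≡q = trans (sym (ℚ.+-assoc z q (- z))) (xyx⁻¹≈y z q)

  singletonP : ∀ {s l y} {X : State → Set} → (∀ r → r < 1ℚ → Tr s l y r) → X y
             → ∀ q → q < 1ℚ → P s l X q
  singletonP tr Xy q q<1 = (_ ∷ []) , ([] ∷ []) , (Xy ∷ []) , singletonSum tr q<1

  P-mono : ∀ {s l} {X Y : State → Set} → (∀ x → X x → Y x) → P s l X ≤ᵣ P s l Y
  P-mono X⊆Y q (xs , uniq , inX , sum) = xs , uniq , All.map (λ {x} → X⊆Y x) inX , sum

  -- For a preorder R and states a, b, the relation R⁺ = R ∪ (R ; {(a,b)} ; R)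
  -- is the least preorder containing R and (a, b).
  module Extension (R : State → State → Set) (isPreorder : IsPreorder _≡_ R)
                   (a b : State) where
    open IsPreorder isPreorder using () renaming (refl to R-refl; trans to R-trans)

    R⁺ : State → State → Set
    R⁺ x y = R x y ⊎ (R x a × R b y)

    R⁺-pair : R⁺ a b
    R⁺-pair = inj₂ (R-refl , R-refl)

    R⁺-trans : ∀ {x y z} → R⁺ x y → R⁺ y z → R⁺ x z
    R⁺-trans (inj₁ xy)        (inj₁ yz)        = inj₁ (R-trans xy yz)
    R⁺-trans (inj₁ xy)        (inj₂ (ya , bz)) = inj₂ (R-trans xy ya , bz)
    R⁺-trans (inj₂ (xa , by)) (inj₁ yz)        = inj₂ (xa , R-trans by yz)
    R⁺-trans (inj₂ (xa , _))  (inj₂ (_ , bz))  = inj₂ (xa , bz)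

    R⁺-preorder : IsPreorder _≡_ R⁺
    R⁺-preorder = record
      { isEquivalence = isEquivalence
      ; reflexive     = λ { refl → inj₁ R-refl }
      ; trans         = R⁺-trans
      }

    extend : (∀ x y → R x y → ∀ l X → P x l X ≤ᵣ P y l (Img R X))
           → (∀ l X → P a l X ≤ᵣ P b l (Img R⁺ X))
           → Simulation R⁺
    extend R-sim a≤b = record { preorder = R⁺-preorder ; sim = R⁺-sim }
      where
      R⊆R⁺ : ∀ {X} y → Img R X y → Img R⁺ X y
      R⊆R⁺ y (x , Xx , xy) = x , Xx , inj₁ xy

      -- x R a, a ≤ b up to R⁺, b R y: the three images collapse into one.
      collapse : ∀ {X} z → Img R (Img R⁺ (Img R X)) z → Img R⁺ X z
      collapse z (w , (u , (x , Xx , xu) , uw) , wz) =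
        x , Xx , R⁺-trans (R⁺-trans (inj₁ xu) uw) (inj₁ wz)

      R⁺-sim : ∀ x y → R⁺ x y → ∀ l X → P x l X ≤ᵣ P y l (Img R⁺ X)
      R⁺-sim x y (inj₁ xy) l X q mass = P-mono R⊆R⁺ q (R-sim x y xy l X q mass)
      R⁺-sim x y (inj₂ (xa , by)) l X q mass =
        P-mono collapse q (R-sim b y by l _ q (a≤b l _ q (R-sim x a xa l X q mass)))

  value-irreducible : ∀ {V Ns} → Value V → Step V Ns → ⊥
  value-irreducible v-nat  ()
  value-irreducible v-bl   ()
  value-irreducible v-nil  ()
  value-irreducible v-lam  ()
  value-irreducible v-fix  ()
  value-irreducible v-cons ()
  value-irreducible v-pair ()

  value-evaluates : ∀ {V} → Value V → ∀ r → r < 1ℚ → Sem V V r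
  value-evaluates vV r r<1 = _ , ⇓val vV , _ , w≡ w[] , r<1

  data ValueMove (V : Tm) (σ : Ty) : Label → State → Set where
    typeLoop : ∀ .{p}   → ValueMove V σ (lty σ) (st V σ p)
    evalHat  : ∀ .{p v} → ValueMove V σ leval (hst V σ p v)

  valueMove-unique : ∀ {V σ l x y} → ValueMove V σ l x → ValueMove V σ l y → x ≡ y
  valueMove-unique typeLoop typeLoop = refl
  valueMove-unique evalHat  evalHat  = refl

  value-transition : ∀ {V σ l x r} .{p} → Value V → Tr (st V σ p) l x r
                   → r < 0ℚ ⊎ (ValueMove V σ l x × r < 1ℚ)
  value-transition vV (neg r<0)  = inj₁ r<0
  value-transition vV (self r<1) = inj₂ (typeLoop , r<1)
  value-transition vV (eval (_ , ⇓∅ , _ , w[] , r<0))              = inj₁ r<0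
  value-transition vV (eval (_ , ⇓val _ , _ , w≡ w[] , r<1))       = inj₂ (evalHat , r<1)
  value-transition vV (eval (_ , ⇓val _ , _ , w≢ _ w[] , r<0))     = inj₁ r<0
  value-transition vV (eval (_ , ⇓step step _ , _)) = ⊥-elim (value-irreducible vV step)

  value-mass : ∀ {V σ l xs q} .{p} → Value V → Unique xs → SumTr (st V σ p) l xs q
             → q < 0ℚ ⊎ (Σ State λ x → x ∈ xs × ValueMove V σ l x × q < 1ℚ)
  value-mass vV [] (s[] q<0) = inj₁ q<0
  value-mass vV (x∉ ∷ uniq) (s∷ tr rest q≤r+t)
    with value-transition vV tr | value-mass vV uniq rest
  ... | inj₁ r<0 | inj₁ t<0 =
    inj₁ (ℚ.≤-<-trans q≤r+t (ℚ.+-mono-< r<0 t<0))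
  ... | inj₁ r<0 | inj₂ (y , y∈ , move , t<1) =
    inj₂ (y , there y∈ , move , ℚ.≤-<-trans q≤r+t (ℚ.+-mono-< r<0 t<1))
  ... | inj₂ (move , r<1) | inj₁ t<0 =
    inj₂ (_ , here refl , move , ℚ.≤-<-trans q≤r+t (ℚ.+-mono-< r<1 t<0))
  ... | inj₂ (move , _) | inj₂ (_ , y∈ , move′ , _) =
    ⊥-elim (All.lookup x∉ y∈ (valueMove-unique move move′))

  value-step : ∀ {σ V W} .{tV tW vV vW} (Q : State → State → Set)
             → Value V → Value W
             → Q (st V σ tV) (st W σ tW) → Q (hst V σ tV vV) (hst W σ tW vW)
             → ∀ l X → P (st V σ tV) l X ≤ᵣ P (st W σ tW) l (Img Q X)
  value-step Q vV vW Qst Qhst l X q (xs , uniq , inX , sum) with value-mass vV uniq sum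
  ... | inj₁ q<0 = [] , [] , [] , s[] q<0
  ... | inj₂ (x , x∈ , typeLoop , q<1) =
    singletonP (λ _ → self) (x , All.lookup inX x∈ , Qst) q q<1
  ... | inj₂ (x , x∈ , evalHat , q<1) =
    singletonP (λ r → eval ∘ value-evaluates vW r) (x , All.lookup inX x∈ , Qhst) q q<1

  -- A simulation relating the term states relates their hatted copies:
  -- the eval mass 1 of (V,σ) into {V̂} must be matched inside R({V̂}).
  hat-of-term : ∀ σ V W (tV : [] ⊢ V ∶ σ) (tW : [] ⊢ W ∶ σ) (vV : Value V) (vW : Value W)
              → st V σ tV ≾ st W σ tW → hst V σ tV vV ≾ hst W σ tW vW
  hat-of-term σ V W tV tW vV vW (R , isSim , VRW) = R , isSim , V̂RŴ
    where
    open Simulation isSim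
    V̂ : State
    V̂ = hst V σ tV vV

    evalMass : P (st V σ tV) leval (_≡ V̂) 0ℚ
    evalMass = singletonP (λ r → eval ∘ value-evaluates vV r) refl 0ℚ (ℚ.positive⁻¹ 1ℚ)

    V̂RŴ : R V̂ (hst W σ tW vW)
    V̂RŴ with sim _ _ VRW leval (_≡ V̂) 0ℚ evalMass
    ... | ys , uniq , inImg , sum with value-mass vW uniq sum
    ... | inj₁ 0<0 = ⊥-elim (ℚ.<-irrefl refl 0<0)
    ... | inj₂ (_ , y∈ , evalHat , _) with All.lookup inImg y∈
    ...   | _ , refl , V̂Ry = V̂Ry

  term-of-hat : ∀ σ V W (tV : [] ⊢ V ∶ σ) (tW : [] ⊢ W ∶ σ) (vV : Value V) (vW : Value W)
              → hst V σ tV vV ≾ hst W σ tW vW → st V σ tV ≾ st W σ tW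
  term-of-hat σ V W tV tW vV vW (R , isSim , V̂RŴ) =
    R⁺ , extend sim (value-step R⁺ vV vW R⁺-pair (inj₁ V̂RŴ)) , R⁺-pair
    where
    open Simulation isSim
    open Extension R preorder (st V σ tV) (st W σ tW)

mainTheorem6 : (O : OpSig) → let open PCFL O in
    ∀ (σ : Ty) (V W : Tm) (tV : [] ⊢ V ∶ σ) (tW : [] ⊢ W ∶ σ)
    (vV : Value V) (vW : Value W) →
    (hst V σ tV vV ≾ hst W σ tW vW) ⇔ (st V σ tV ≾ st W σ tW)
mainTheorem6 O σ V W tV tW vV vW =
  mk⇔ (term-of-hat O σ V W tV tW vV vW) (hat-of-term O σ V W tV tW vV vW)
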